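{- Fix an integer $k\ge1$. For an object $(A,Z)$ of $\mathbf{FR}_k$, let $A^*$ be the free abelian group on the set $A$ (with basis elements $[a]$, $a\in A$), let $$X_A=\{[a_1]+\cdots+[a_k]-[a'_1]-\cdots-[a'_k] \;:\; a_i,a'_i\in A,\ a_1+\cdots+a_k=a'_1+\cdots+a'_k \text{ in } Z\}\subseteq A^*,$$ let $Z'=A^*/\langle X_A\rangle$, and let $A'\subseteq Z'$ be the image of $A$ under $a\mapsto [a]+\langle X_A\rangle$. Define $F(A,Z)=(A',Z')$, and for a morphism $f:(A,Z)\to(B,W)$ of $\mathbf{FR}_k$ define $F(f):A'\to B'$ by $F(f)([a]+\langle X_A\rangle)=[f(a)]+\langle X_B\rangle$. Then $F$ is a functor $\mathbf{FR}_k\to\mathbf{FR}_k$, and $F$ is left adjoint to the identity functor $\mathrm{Id}:\mathbf{FR}_k\to\mathbf{FR}_k$; that is, there are bijections $\mathbf{FR}_k(F(A,Z),(B,W))\cong\mathbf{FR}_k((A,Z),(B,W))$, natural in $(A,Z)$ and $(B,W)$.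
   Context: An additive set $(A,Z)$ is a pair where $Z$ is an abelian group and $A$ is a finite non-empty subset of $Z$. For additive sets $(A,Z)$, $(B,W)$ and an integer $k\ge1$, a Freiman homomorphism of order $k$ $\phi:(A,Z)\to(B,W)$ is a map $\phi:A\to B$ such that for all $a_1,\dots,a_k,a'_1,\dots,a'_k\in A$, $a_1+\cdots+a_k=a'_1+\cdots+a'_k$ implies $\phi(a_1)+\cdots+\phi(a_k)=\phi(a'_1)+\cdots+\phi(a'_k)$. The Freiman category $\mathbf{FR}_k$ has additive sets as objects and Freiman homomorphisms of order $k$ as morphisms, with composition being composition of maps; $\mathbf{FR}_k(P,Q)$ denotes the set of morphisms from $P$ to $Q$. -}

module Defs where

open import Level using (0ℓ)
open import Data.Nat using (ℕ; zero; suc; _≤_)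
open import Data.Fin using (Fin; zero; suc)
open import Data.Fin.Properties using (_≟_)
open import Data.Integer as ℤ using (ℤ; 0ℤ; 1ℤ; _-_; -_)
import Data.Integer.Properties as ℤP
open import Data.Integer.Tactic.RingSolver using (solve-∀)
open import Data.Product using (Σ; _,_; proj₁; proj₂)
open import Function using (_∘_; id)
open import Relation.Nullary using (yes; no)
open import Relation.Binary.PropositionalEquality as Eq using (_≡_; refl)
open import Algebra.Bundles using (AbelianGroup)
open import Algebra.Structures using (IsAbelianGroup; IsGroup; IsMonoid; IsSemigroup; IsMagma)
open import Relation.Binary.Structures using (IsEquivalence)

sumG : (G : AbelianGroup 0ℓ 0ℓ) (k : ℕ) → (Fin k → AbelianGroup.Carrier G) → AbelianGroup.Carrier G
sumG G zero    f = AbelianGroup.ε G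
sumG G (suc k) f = AbelianGroup._∙_ G (f zero) (sumG G k (f ∘ suc))

-- Additive sets.  The finite non-empty subset A ⊆ Z is given by an
-- enumeration  elt : Fin n → Z  with n ≥ 1; A is the image of elt.
-- (elt need not be injective.)

record AddSet : Set₁ where
  field
    Z        : AbelianGroup 0ℓ 0ℓ
    n        : ℕ
    nonempty : 1 ≤ n
    elt      : Fin n → AbelianGroup.Carrier Z

  open AbelianGroup Z public using (Carrier; _≈_)

  Σ⟨_⟩ : {k : ℕ} → (Fin k → Fin n) → Carrier
  Σ⟨_⟩ {k} a = sumG Z k (elt ∘ a)

open AddSet public using (Z; n; elt)

IsFreiman : (k : ℕ) (P Q : AddSet) → (Fin (n P) → Fin (n Q)) → Set
IsFreiman k P Q φ =
  (a a' : Fin k → Fin (n P)) →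
  AddSet._≈_ P (AddSet.Σ⟨_⟩ P a) (AddSet.Σ⟨_⟩ P a') →
  AddSet._≈_ Q (AddSet.Σ⟨_⟩ Q (φ ∘ a)) (AddSet.Σ⟨_⟩ Q (φ ∘ a'))

record Hom (k : ℕ) (P Q : AddSet) : Set where
  constructor _,_
  field
    map     : Fin (n P) → Fin (n Q)
    freiman : IsFreiman k P Q map

open Hom public

-- Two morphisms are equal iff they agree as maps A → B, i.e. they send
-- each element of A to the same element of B ⊆ W.
_≈H_ : {k : ℕ} {P Q : AddSet} → Hom k P Q → Hom k P Q → Set
_≈H_ {k} {P} {Q} φ ψ = ∀ i → AddSet._≈_ Q (elt Q (map φ i)) (elt Q (map ψ i))

idH : {k : ℕ} (P : AddSet) → Hom k P P
idH P = id , λ a a' h → h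

_∘H_ : {k : ℕ} {P Q R : AddSet} → Hom k Q R → Hom k P Q → Hom k P R
(g , pg) ∘H (f , pf) = (g ∘ f) , λ a a' h → pg (f ∘ a) (f ∘ a') (pf a a' h)

-- The free abelian group A* on A = Fin n is ℤ^(Fin n) (finitely supported
-- automatically since A is finite); [i] is the i-th basis vector.

basis : {m : ℕ} → Fin m → Fin m → ℤ
basis i j with i ≟ j
... | yes _ = 1ℤ
... | no  _ = 0ℤ

sumB : {m : ℕ} (k : ℕ) → (Fin k → Fin m) → Fin m → ℤ
sumB zero    a j = 0ℤ
sumB (suc k) a j = basis (a zero) j ℤ.+ sumB k (a ∘ suc) j

module Quotient (k : ℕ) (P : AddSet) where
  open AddSet P using (_≈_; Σ⟨_⟩)

  N : ℕ
  N = n P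

  data InX : (Fin N → ℤ) → Set where
    gen  : (a a' : Fin k → Fin N) → Σ⟨ a ⟩ ≈ Σ⟨ a' ⟩ →
           InX (λ j → sumB k a j - sumB k a' j)
    zer  : InX (λ _ → 0ℤ)
    add  : ∀ {u v} → InX u → InX v → InX (λ j → u j ℤ.+ v j)
    neg  : ∀ {u} → InX u → InX (λ j → - u j)
    resp : ∀ {u v} → (∀ j → u j ≡ v j) → InX u → InX v

  _≈'_ : (Fin N → ℤ) → (Fin N → ℤ) → Set
  u ≈' v = InX (λ j → u j - v j)

  byEq : ∀ {u v} → (∀ j → u j ≡ v j) → u ≈' v
  byEq {u} {v} e = resp (λ j → Eq.trans (Eq.sym (ℤP.+-inverseʳ (u j))) (Eq.cong (λ t → u j - t) (e j))) zer

  private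
    l-sym : ∀ a b → - (a - b) ≡ b - a
    l-sym = solve-∀
    l-trans : ∀ a b c → (a - b) ℤ.+ (b - c) ≡ a - c
    l-trans = solve-∀
    l-cong : ∀ a b c d → (a - b) ℤ.+ (c - d) ≡ (a ℤ.+ c) - (b ℤ.+ d)
    l-cong = solve-∀
    l-neg : ∀ a b → - (a - b) ≡ (- a) - (- b)
    l-neg = solve-∀

  isAG : IsAbelianGroup _≈'_ (λ u v j → u j ℤ.+ v j) (λ _ → 0ℤ) (λ u j → - u j)
  isAG = record
    { isGroup = record
      { isMonoid = record
        { isSemigroup = record
          { isMagma = record
            { isEquivalence = record
              { refl  = λ {u} → byEq {u} {u} (λ _ → refl)
              ; sym   = λ {u} {v} p → resp (λ j → l-sym (u j) (v j)) (neg p)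
              ; trans = λ {u} {v} {w} p q → resp (λ j → l-trans (u j) (v j) (w j)) (add p q)
              }
            ; ∙-cong = λ {u} {u'} {v} {v'} p q → resp (λ j → l-cong (u j) (u' j) (v j) (v' j)) (add p q)
            }
          ; assoc = λ u v w → byEq (λ j → ℤP.+-assoc (u j) (v j) (w j))
          }
        ; identity = (λ u → byEq (λ j → ℤP.+-identityˡ (u j)))
                   , (λ u → byEq (λ j → ℤP.+-identityʳ (u j)))
        }
      ; inverse = (λ u → byEq (λ j → ℤP.+-inverseˡ (u j)))
                , (λ u → byEq (λ j → ℤP.+-inverseʳ (u j)))
      ; ⁻¹-cong = λ {u} {v} p → resp (λ j → l-neg (u j) (v j)) (neg p)
      }
    ; comm = λ u v → byEq (λ j → ℤP.+-comm (u j) (v j))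
    }

  Z' : AbelianGroup 0ℓ 0ℓ
  Z' = record
    { Carrier = Fin N → ℤ
    ; _≈_ = _≈'_
    ; _∙_ = λ u v j → u j ℤ.+ v j
    ; ε = λ _ → 0ℤ
    ; _⁻¹ = λ u j → - u j
    ; isAbelianGroup = isAG
    }

FObj : (k : ℕ) → AddSet → AddSet
FObj k P = record
  { Z        = Quotient.Z' k P
  ; n        = n P
  ; nonempty = AddSet.nonempty P
  ; elt      = basis
  }

-- That this is a Freiman
-- homomorphism F(A,Z) → F(B,W) is part of the claim, so it is supplied
-- as a proof  ok  here.
FMapOK : (k : ℕ) → Set₁
FMapOK k = {P Q : AddSet} (f : Hom k P Q) → IsFreiman k (FObj k P) (FObj k Q) (map f)

Fmap : {k : ℕ} → FMapOK k → {P Q : AddSet} → Hom k P Q → Hom k (FObj k P) (FObj k Q)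
Fmap ok f = map f , ok f

-- A map e : A → W into any abelian group that respects the k-fold relations of A extends
-- linearly to A* → W; each generator [a₁]+⋯+[a_k]−[a'₁]−⋯−[a'_k] of X_A goes to
-- e(a₁)+⋯+e(a_k) − e(a'₁)−⋯−e(a'_k) = 0, so the extension kills ⟨X_A⟩ and e becomes a
-- Freiman map out of F(A,Z) = (A', Z').  Conversely a ↦ [a] is Freiman A → A'.  Thus
-- Freiman maps F(A,Z) → (B,W) and (A,Z) → (B,W) have the same underlying maps, and the
-- adjunction bijection, its inverse and naturality are all identities on those maps.
module Submission where

open import Level using (0ℓ)
open import Defs
open import Data.Nat as ℕ using (ℕ; zero; suc; _≤_)
import Data.Nat.Properties as ℕP
open import Data.Fin using (Fin; zero; suc)
open import Data.Fin.Properties using (_≟_)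
open import Data.Integer as ℤ using (ℤ; +_; -[1+_]; 0ℤ; _-_; -_; _⊖_)
import Data.Integer.Properties as ℤP
open import Data.Integer.Tactic.RingSolver using (solve-∀)
open import Data.Product using (Σ; _×_; _,_)
open import Data.Vec.Functional using (_∷_)
open import Function using (_∘_; id; const)
open import Relation.Nullary using (yes; no)
open import Relation.Binary.PropositionalEquality as Eq using (_≡_)
open import Algebra.Bundles using (AbelianGroup)

module IntegerMultiple (G : AbelianGroup 0ℓ 0ℓ) where
  open AbelianGroup G hiding (_-_)
  open import Algebra.Properties.AbelianGroup G
  open import Algebra.Properties.CommutativeSemigroup commutativeSemigroup using (interchange)
  open import Algebra.Properties.Monoid.Mult monoid using (×-homo-+) renaming (_×_ to _×ℕ_)
  open import Relation.Binary.Reasoning.Setoid setoid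

  infixr 8 _·_

  _·_ : ℤ → Carrier → Carrier
  (+ m)    · x = m ×ℕ x
  -[1+ m ] · x = (suc m ×ℕ x) ⁻¹

  ⊖-· : ∀ m n x → (m ⊖ n) · x ≈ m ×ℕ x ∙ (n ×ℕ x) ⁻¹
  ⊖-· m       zero    x = sym (trans (∙-congˡ ε⁻¹≈ε) (identityʳ _))
  ⊖-· zero    (suc n) x = sym (identityˡ _)
  ⊖-· (suc m) (suc n) x = begin
    (suc m ⊖ suc n) · x              ≡⟨ Eq.cong (_· x) (ℤP.[1+m]⊖[1+n]≡m⊖n m n) ⟩
    (m ⊖ n) · x                      ≈⟨ ⊖-· m n x ⟩
    m ×ℕ x ∙ (n ×ℕ x) ⁻¹             ≈⟨ identityˡ _ ⟨
    ε ∙ (m ×ℕ x ∙ (n ×ℕ x) ⁻¹)       ≈⟨ ∙-congʳ (inverseʳ x) ⟨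
    x ∙ x ⁻¹ ∙ (m ×ℕ x ∙ (n ×ℕ x) ⁻¹) ≈⟨ interchange x (x ⁻¹) (m ×ℕ x) ((n ×ℕ x) ⁻¹) ⟩
    x ∙ m ×ℕ x ∙ (x ⁻¹ ∙ (n ×ℕ x) ⁻¹) ≈⟨ ∙-congˡ (⁻¹-∙-comm x (n ×ℕ x)) ⟩
    x ∙ m ×ℕ x ∙ (x ∙ n ×ℕ x) ⁻¹     ∎

  ·-homo-+ : ∀ i j x → (i ℤ.+ j) · x ≈ i · x ∙ j · x
  ·-homo-+ (+ m)    (+ n)    x = ×-homo-+ x m n
  ·-homo-+ (+ m)    -[1+ n ] x = ⊖-· m (suc n) x
  ·-homo-+ -[1+ m ] (+ n)    x = trans (⊖-· n (suc m) x) (comm _ _)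
  ·-homo-+ -[1+ m ] -[1+ n ] x = begin
    (suc (suc (m ℕ.+ n)) ×ℕ x) ⁻¹    ≡⟨ Eq.cong (λ t → (suc t ×ℕ x) ⁻¹) (ℕP.+-suc m n) ⟨
    ((suc m ℕ.+ suc n) ×ℕ x) ⁻¹      ≈⟨ ⁻¹-cong (×-homo-+ x (suc m) (suc n)) ⟩
    (suc m ×ℕ x ∙ suc n ×ℕ x) ⁻¹     ≈⟨ ⁻¹-∙-comm _ _ ⟨
    (suc m ×ℕ x) ⁻¹ ∙ (suc n ×ℕ x) ⁻¹ ∎

module LinearExtension (G : AbelianGroup 0ℓ 0ℓ) where
  open AbelianGroup G hiding (_-_)
  open import Algebra.Properties.AbelianGroup G
  open import Algebra.Properties.CommutativeMonoid.Sum commutativeMonoid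
    using (sum; ∑-distrib-+; sum-cong-≋; sum-replicate-zero)
  open IntegerMultiple G

  linear : ∀ {m} → (Fin m → Carrier) → (Fin m → ℤ) → Carrier
  linear e u = sum (λ j → u j · e j)

  module _ {m : ℕ} (e : Fin m → Carrier) where

    linear-cong : ∀ {u v} → (∀ j → u j ≡ v j) → linear e u ≈ linear e v
    linear-cong u≗v = sum-cong-≋ (λ j → reflexive (Eq.cong (_· e j) (u≗v j)))

    linear-homo-0 : ∀ {u} → (∀ j → u j ≡ 0ℤ) → linear e u ≈ ε
    linear-homo-0 u≗0 = trans (linear-cong u≗0) (sum-replicate-zero m)

    linear-homo-+ : ∀ u v → linear e (λ j → u j ℤ.+ v j) ≈ linear e u ∙ linear e v
    linear-homo-+ u v = trans (sum-cong-≋ (λ j → ·-homo-+ (u j) (v j) (e j)))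
      (∑-distrib-+ (λ j → u j · e j) (λ j → v j · e j))

    linear-homo-neg : ∀ u → linear e (λ j → - u j) ≈ linear e u ⁻¹
    linear-homo-neg u = inverseˡ-unique _ _
      (trans (sym (linear-homo-+ (λ j → - u j) u)) (linear-homo-0 (λ j → ℤP.+-inverseˡ (u j))))

    linear-homo-- : ∀ u v → linear e (λ j → u j - v j) ≈ linear e u ∙ linear e v ⁻¹
    linear-homo-- u v = trans (linear-homo-+ u (λ j → - v j)) (∙-congˡ (linear-homo-neg v))

  basis-suc : ∀ {m} (i j : Fin m) → basis (suc i) (suc j) ≡ basis i j
  basis-suc i j with i ≟ j
  ... | yes _ = Eq.refl
  ... | no  _ = Eq.refl

  linear-basis : ∀ {m} (e : Fin m → Carrier) i → linear e (basis i) ≈ e i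
  linear-basis e zero    = trans (∙-cong (identityʳ _) (linear-homo-0 (e ∘ suc) (λ _ → Eq.refl))) (identityʳ _)
  linear-basis e (suc i) =
    trans (identityˡ _) (trans (linear-cong (e ∘ suc) (basis-suc i)) (linear-basis (e ∘ suc) i))

  linear-sumB : ∀ {m} (e : Fin m → Carrier) k (a : Fin k → Fin m) → linear e (sumB k a) ≈ sumG G k (e ∘ a)
  linear-sumB e zero    a = linear-homo-0 e (λ _ → Eq.refl)
  linear-sumB e (suc k) a = trans (linear-homo-+ e (basis (a zero)) (sumB k (a ∘ suc)))
    (∙-cong (linear-basis e (a zero)) (linear-sumB e k (a ∘ suc)))

sumG-Z'-basis : ∀ k P m (a : Fin m → Fin (n P)) j →
  sumG (Quotient.Z' k P) m (basis ∘ a) j ≡ sumB m a j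
sumG-Z'-basis k P zero    a j = Eq.refl
sumG-Z'-basis k P (suc m) a j = Eq.cong (ℤ._+_ (basis (a zero) j)) (sumG-Z'-basis k P m (a ∘ suc) j)

basis-isFreiman : ∀ k P → IsFreiman k P (FObj k P) id
basis-isFreiman k P a a' Σa≈Σa' =
  Quotient.resp (λ j → Eq.cong₂ _-_ (Eq.sym (sumG-Z'-basis k P k a j)) (Eq.sym (sumG-Z'-basis k P k a' j)))
    (Quotient.gen a a' Σa≈Σa')

unit : ∀ {k} P → Hom k P (FObj k P)
unit P = id , basis-isFreiman _ P

module _ {k : ℕ} {P Q : AddSet} (f : Hom k P Q) where
  open AbelianGroup (Z Q) hiding (_-_)
  open import Algebra.Properties.AbelianGroup (Z Q)
  open import Relation.Binary.Reasoning.Setoid setoid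
  open LinearExtension (Z Q)
  open Quotient k P using (InX; gen; zer; add; neg; resp; _≈'_)

  private
    e : Fin (n P) → Carrier
    e = elt Q ∘ map f

    Σ' : (Fin k → Fin (n P)) → Fin (n P) → ℤ
    Σ' = AddSet.Σ⟨_⟩ (FObj k P)

  InX⇒linear≈ε : ∀ {u} → InX u → linear e u ≈ ε
  InX⇒linear≈ε (gen a a' Σa≈Σa') = begin
    linear e (λ j → sumB k a j - sumB k a' j)           ≈⟨ linear-homo-- e (sumB k a) (sumB k a') ⟩
    linear e (sumB k a) ∙ linear e (sumB k a') ⁻¹       ≈⟨ ∙-cong (linear-sumB e k a) (⁻¹-cong (linear-sumB e k a')) ⟩
    sumG (Z Q) k (e ∘ a) ∙ sumG (Z Q) k (e ∘ a') ⁻¹     ≈⟨ x≈y⇒x∙y⁻¹≈ε (freiman f a a' Σa≈Σa') ⟩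
    ε                                                   ∎
  InX⇒linear≈ε zer          = linear-homo-0 e (λ _ → Eq.refl)
  InX⇒linear≈ε (add {u} {v} u∈X v∈X) =
    trans (linear-homo-+ e u v) (trans (∙-cong (InX⇒linear≈ε u∈X) (InX⇒linear≈ε v∈X)) (identityˡ ε))
  InX⇒linear≈ε (neg {u} u∈X) = trans (linear-homo-neg e u) (trans (⁻¹-cong (InX⇒linear≈ε u∈X)) ε⁻¹≈ε)
  InX⇒linear≈ε (resp u≗v u∈X) = trans (sym (linear-cong e u≗v)) (InX⇒linear≈ε u∈X)

  linear-resp-≈' : ∀ {u v} → u ≈' v → linear e u ≈ linear e v
  linear-resp-≈' {u} {v} u≈'v = x∙y⁻¹≈ε⇒x≈y _ _ (trans (sym (linear-homo-- e u v)) (InX⇒linear≈ε u≈'v))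

  extend-isFreiman : IsFreiman k (FObj k P) Q (map f)
  extend-isFreiman a a' Σa≈Σa' = begin
    sumG (Z Q) k (e ∘ a)   ≈⟨ linear-Σ' a ⟨
    linear e (Σ' a)        ≈⟨ linear-resp-≈' {Σ' a} Σa≈Σa' ⟩
    linear e (Σ' a')       ≈⟨ linear-Σ' a' ⟩
    sumG (Z Q) k (e ∘ a')  ∎
    where
    linear-Σ' : ∀ a → linear e (Σ' a) ≈ sumG (Z Q) k (e ∘ a)
    linear-Σ' a = trans (linear-cong e (sumG-Z'-basis k P k a)) (linear-sumB e k a)

  extend : Hom k (FObj k P) Q
  extend = map f , extend-isFreiman

F-isFreiman : ∀ {k} → FMapOK k
F-isFreiman f = extend-isFreiman (unit _ ∘H f)

-- a = a' in Z yields the defining relation [a] + (k−1)[a] = [a'] + (k−1)[a] of ⟨X_A⟩; for k = 0 there is none.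
basis-cong : ∀ {k} Q → 1 ≤ k → ∀ {x y} →
  AddSet._≈_ Q (elt Q x) (elt Q y) → AddSet._≈_ (FObj k Q) (basis x) (basis y)
basis-cong {suc k} Q _ {x} {y} x≈y =
  Quotient.resp (λ j → cancel (basis x j) (basis y j) (sumB k (const x) j))
    (Quotient.gen (const x) (y ∷ const x) (AbelianGroup.∙-congʳ (Z Q) x≈y))
  where
  cancel : ∀ a b s → (a ℤ.+ s) - (b ℤ.+ s) ≡ a - b
  cancel = solve-∀

restrict : ∀ {k P Q} → Hom k (FObj k P) Q → Hom k P Q
restrict {P = P} h = h ∘H unit P

mainTheorem8 : (k : ℕ) → 1 ≤ k →
    Σ (FMapOK k) λ ok →
    ( ({P Q : AddSet} {f g : Hom k P Q} → f ≈H g → Fmap ok f ≈H Fmap ok g)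
    × ({P : AddSet} → Fmap ok (idH P) ≈H idH (FObj k P))
    × ({P Q R : AddSet} (g : Hom k Q R) (f : Hom k P Q) →
    Fmap ok (g ∘H f) ≈H (Fmap ok g ∘H Fmap ok f)) )
    × Σ ({P Q : AddSet} → Hom k (FObj k P) Q → Hom k P Q) λ Φ →
    Σ ({P Q : AddSet} → Hom k P Q → Hom k (FObj k P) Q) λ Ψ →
    ({P Q : AddSet} {h h' : Hom k (FObj k P) Q} → h ≈H h' → Φ h ≈H Φ h')
    × ({P Q : AddSet} {f f' : Hom k P Q} → f ≈H f' → Ψ f ≈H Ψ f')
    × ({P Q : AddSet} (f : Hom k P Q) → Φ (Ψ f) ≈H f)
    × ({P Q : AddSet} (h : Hom k (FObj k P) Q) → Ψ (Φ h) ≈H h)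
    × ({P P' Q Q' : AddSet} (f : Hom k P' P) (g : Hom k Q Q')
    (h : Hom k (FObj k P) Q) →
    Φ (g ∘H (h ∘H Fmap ok f)) ≈H (g ∘H (Φ h ∘H f)))
mainTheorem8 k k≥1 =
  F-isFreiman ,
  ( (λ {_} {Q} f≈g i → basis-cong Q k≥1 (f≈g i))
  , (λ {P} i → AbelianGroup.refl (Z (FObj k P)) {basis i})
  , (λ {R = R} g f i → AbelianGroup.refl (Z (FObj k R)) {basis (map g (map f i))}) ) ,
  restrict , extend ,
  id , id ,
  (λ {Q = Q} f i → AbelianGroup.refl (Z Q)) ,
  (λ {Q = Q} h i → AbelianGroup.refl (Z Q)) ,
  (λ {Q' = Q'} f g h i → AbelianGroup.refl (Z Q'))
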